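{- Let $G$ be a skeletal antiprismatic thickening with $\alpha(G)\geq 3$. Then $G$ contains a good triad.
   Context: A triad is a stable set of size three. A graph $H$ is antiprismatic if for every triad $T$, every vertex of $H-T$ has exactly two neighbours in $T$. A matching $M\subseteq E(H)$ is changeable in an antiprismatic graph $H$ if $H-M'$ is antiprismatic for every $M'\subseteq M$. A thickening of $H$ under $M$: replace each vertex $v$ by a nonempty clique $I(v)$ (disjoint), with $I(u)$ complete to $I(v)$ if $uv\in E(H)$ and anticomplete otherwise, then for every $uv\in M$ remove a nonempty proper subset of the edges between $I(u)$ and $I(v)$. An antiprismatic thickening is a thickening of an antiprismatic graph under a changeable matching. A homogeneous pair of cliques is a pair $(A,B)$ of disjoint nonempty cliques with $|A\cup B|\ge 3$ such that every vertex outside $A\cup B$ is adjacent to all or none of $A$ and to all or none of $B$; it is skeletal if no edge between $A$ and $B$ can be removed without changing $\omega(G[A\cup B])$; a graph is skeletal if it has no nonskeletal homogeneous pair of cliques. Two vertices are twins if they have the same closed neighbourhood $\tilde N(\cdot)=N(\cdot)\cup\{\cdot\}$; $u$ trumps $v$ if $\tilde N(v)\subsetneq\tilde N(u)$. A triad $T$ is good if every vertex of $G-T$ has two neighbours in $T$, or a twin in $T$, or is trumped by a vertex of $T$. -}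

module Defs where

open import Data.Nat using (ℕ; _≤_; _+_)
open import Data.Bool using (Bool; true; false; _∧_; _∨_; not)
open import Data.Fin using (Fin; _≟_)
open import Data.Fin.Subset using (Subset; _∈_; _∉_; _⊆_; ∣_∣; _∪_)
open import Data.Product using (Σ; ∃; ∃-syntax; _×_; _,_)
open import Data.Sum using (_⊎_)
open import Relation.Nullary using (¬_; Dec; yes; no)
open import Relation.Nullary.Decidable using (⌊_⌋)
open import Relation.Binary.PropositionalEquality using (_≡_; _≢_)
open import Function using (_⇔_)

Rel : ℕ → Set
Rel n = Fin n → Fin n → Bool

record Graph : Set where
  field
    n      : ℕ
    adj    : Rel n
    sym    : ∀ u v → adj u v ≡ adj v u
    irrefl : ∀ v → adj v v ≡ false
open Graph public

module _ {n : ℕ} (E : Rel n) where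

  IsTriadR : Fin n → Fin n → Fin n → Set
  IsTriadR a b c = a ≢ b × a ≢ c × b ≢ c
                 × E a b ≡ false × E a c ≡ false × E b c ≡ false

  nbrCount : Fin n → Fin n → Fin n → Fin n → ℕ
  nbrCount v a b c = b2n (E v a) + b2n (E v b) + b2n (E v c)
    where
    b2n : Bool → ℕ
    b2n true  = 1
    b2n false = 0

  IsAntiprismaticR : Set
  IsAntiprismaticR = ∀ a b c → IsTriadR a b c →
    ∀ v → v ≢ a → v ≢ b → v ≢ c → nbrCount v a b c ≡ 2

  removeEdges : Rel n → Rel n
  removeEdges F u v = E u v ∧ not (F u v)

  IsCliqueIn : Subset n → Subset n → Set
  IsCliqueIn S C = C ⊆ S × (∀ x y → x ∈ C → y ∈ C → x ≢ y → E x y ≡ true)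

  IsCliqueNumberOf : Subset n → ℕ → Set
  IsCliqueNumberOf S k =
    (∃[ C ] (IsCliqueIn S C × ∣ C ∣ ≡ k))
    × (∀ C → IsCliqueIn S C → ∣ C ∣ ≤ k)

singleEdge : {n : ℕ} → Fin n → Fin n → Rel n
singleEdge a b x y = (⌊ x ≟ a ⌋ ∧ ⌊ y ≟ b ⌋) ∨ (⌊ x ≟ b ⌋ ∧ ⌊ y ≟ a ⌋)

Adj : (G : Graph) → Fin (n G) → Fin (n G) → Set
Adj G u v = adj G u v ≡ true

IsTriad : (G : Graph) → Fin (n G) → Fin (n G) → Fin (n G) → Set
IsTriad G = IsTriadR (adj G)

AlphaAtLeast3 : Graph → Set
AlphaAtLeast3 G = ∃[ a ] ∃[ b ] ∃[ c ] IsTriad G a b c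

IsAntiprismatic : Graph → Set
IsAntiprismatic G = IsAntiprismaticR (adj G)

IsMatching : (H : Graph) → Rel (n H) → Set
IsMatching H M =
    (∀ u v → M u v ≡ M v u)
  × (∀ u v → M u v ≡ true → adj H u v ≡ true)
  × (∀ u v w → M u v ≡ true → M u w ≡ true → v ≡ w)

IsChangeable : (H : Graph) → Rel (n H) → Set
IsChangeable H M =
  ∀ (M' : Rel (n H)) → (∀ u v → M' u v ≡ M' v u) →
  (∀ u v → M' u v ≡ true → M u v ≡ true) →
  IsAntiprismaticR (removeEdges (adj H) M')

-- G is a thickening of H under M, witnessed by φ : V(G) → V(H)
-- (I(v) = φ⁻¹(v)).
IsThickeningVia : (G H : Graph) → Rel (n H) → (Fin (n G) → Fin (n H)) → Set
IsThickeningVia G H M φ =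
    (∀ v → ∃[ x ] φ x ≡ v)
  × (∀ x y → φ x ≡ φ y → x ≢ y → adj G x y ≡ true)
  × (∀ x y → φ x ≢ φ y → adj H (φ x) (φ y) ≡ true → M (φ x) (φ y) ≡ false
       → adj G x y ≡ true)
  × (∀ x y → φ x ≢ φ y → adj H (φ x) (φ y) ≡ false → adj G x y ≡ false)
    -- for uv ∈ M, a nonempty proper subset of the I(u)–I(v) edges is removed
  × (∀ u v → M u v ≡ true →
       (∃[ x ] ∃[ y ] (φ x ≡ u × φ y ≡ v × adj G x y ≡ true))
     × (∃[ x ] ∃[ y ] (φ x ≡ u × φ y ≡ v × adj G x y ≡ false)))

IsAntiprismaticThickening : Graph → Set
IsAntiprismaticThickening G =
  Σ Graph λ H → Σ (Rel (n H)) λ M → Σ (Fin (n G) → Fin (n H)) λ φ →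
    IsAntiprismatic H × IsMatching H M × IsChangeable H M × IsThickeningVia G H M φ

IsHomogeneousPairOfCliques : (G : Graph) → Subset (n G) → Subset (n G) → Set
IsHomogeneousPairOfCliques G A B =
    (∀ x → x ∈ A → x ∉ B)
  × (∃[ x ] x ∈ A) × (∃[ x ] x ∈ B)
  × (∀ x y → x ∈ A → y ∈ A → x ≢ y → Adj G x y)
  × (∀ x y → x ∈ B → y ∈ B → x ≢ y → Adj G x y)
  × 3 ≤ ∣ A ∪ B ∣
  × (∀ v → v ∉ A → v ∉ B →
       ((∀ x → x ∈ A → Adj G v x) ⊎ (∀ x → x ∈ A → ¬ Adj G v x))
     × ((∀ x → x ∈ B → Adj G v x) ⊎ (∀ x → x ∈ B → ¬ Adj G v x)))

IsSkeletalPair : (G : Graph) → Subset (n G) → Subset (n G) → Set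
IsSkeletalPair G A B =
  ∀ a b → a ∈ A → b ∈ B → Adj G a b →
  ∀ k → IsCliqueNumberOf (adj G) (A ∪ B) k →
        ¬ IsCliqueNumberOf (removeEdges (adj G) (singleEdge a b)) (A ∪ B) k

IsSkeletal : Graph → Set
IsSkeletal G = ∀ A B → IsHomogeneousPairOfCliques G A B → IsSkeletalPair G A B

InClosedNbhd : (G : Graph) → Fin (n G) → Fin (n G) → Set
InClosedNbhd G v w = w ≡ v ⊎ Adj G v w

AreTwins : (G : Graph) → Fin (n G) → Fin (n G) → Set
AreTwins G u v = ∀ w → InClosedNbhd G u w ⇔ InClosedNbhd G v w

Trumps : (G : Graph) → Fin (n G) → Fin (n G) → Set
Trumps G u v = (∀ w → InClosedNbhd G v w → InClosedNbhd G u w)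
             × (∃[ w ] (InClosedNbhd G u w × ¬ InClosedNbhd G v w))

IsGoodTriad : (G : Graph) → Fin (n G) → Fin (n G) → Fin (n G) → Set
IsGoodTriad G a b c = IsTriad G a b c ×
  (∀ v → v ≢ a → v ≢ b → v ≢ c →
      nbrCount (adj G) v a b c ≡ 2
    ⊎ (AreTwins G v a ⊎ AreTwins G v b ⊎ AreTwins G v c)
    ⊎ (Trumps G a v ⊎ Trumps G b v ⊎ Trumps G c v))

-- Let G be a thickening of H under M via φ, with triad {a, b, c}; the classes of
-- a, b, c are distinct.  If no two of them are matched, their images form a triad
-- of H and no edge u s of M touches it: deleting u s would lower the number of
-- neighbours of u in the triad, which changeability forces to be 2 both before and
-- after.  So vertices outside the three classes have two neighbours in {a, b, c}
-- and vertices inside are twins.  If I(p), I(q) are matched, skeletality of the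
-- homogeneous pair (I(p), I(q)) makes its crossing edges "transitive"
-- (x₁y₁, x₂y₂ ⇒ x₁y₂), so a and b can be re-chosen with b anticomplete to I(p) and
-- a adjacent to some y₀ ∈ I(q).  Then a vertex of I(p) is a twin of a or trumped
-- by a (according to its adjacency to y₀), and a vertex of I(q) is a twin of b or
-- adjacent to both a and b.
module Submission where

open import Data.Bool using (true; false; _∧_; _∨_; not)
open import Data.Bool.Properties
  using (∧-zeroʳ; ∧-identityʳ; ∧-conicalˡ; ∨-zeroʳ; ¬-not; not-¬; ⇔→≡)
  renaming (_≟_ to _≟ᵇ_)
open import Data.Empty using (⊥-elim)
open import Data.Fin using (Fin; suc) renaming (_≟_ to _≟ᶠ_)
open import Data.Fin.Properties using (any?; all?)
open import Data.Fin.Subset using (Subset; _∈_; ∣_∣; _∪_) renaming (⊥ to ∅)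
open import Data.Fin.Subset.Properties
  using (∉⊥; _∈?_; _⊆?_; anySubset?; ∣p∣≤n; ∣p∣≤∣x∷p∣; p⊆p∪q; q⊆p∪q)
open import Data.Nat using (ℕ; zero; suc; _≤_; _≤?_; z≤n; s≤s)
open import Data.Nat.Properties using (≤-trans; ≰⇒>; ≤-pred; 1+n≢n)
open import Data.Product using (∃-syntax; _×_; _,_; proj₁; proj₂)
import Data.Product as Product
open import Data.Sum using (_⊎_; inj₁; inj₂)
import Data.Sum as Sum
open import Data.Vec using (_∷_; tabulate; here; there)
open import Data.Vec.Properties using (lookup∘tabulate; []=⇒lookup; lookup⇒[]=)
open import Function using (_∘_; mk⇔)
open import Relation.Nullary using (¬_; Dec; yes; no)
open import Relation.Nullary.Decidable using (⌊_⌋; _×-dec_; _→-dec_; ¬?; dec-true; isYes≗does)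
open import Relation.Binary.PropositionalEquality

open import Defs hiding (sym)

Among : {A : Set} → A → A → A → A → Set
Among s p q r = s ≡ p ⊎ s ≡ q ⊎ s ≡ r

GoodVertex : (G : Graph) → (a b c v : Fin (n G)) → Set
GoodVertex G a b c v =
    nbrCount (adj G) v a b c ≡ 2
  ⊎ (AreTwins G v a ⊎ AreTwins G v b ⊎ AreTwins G v c)
  ⊎ (Trumps G a v ⊎ Trumps G b v ⊎ Trumps G c v)

nbrCount-cong : ∀ {m k} (E : Rel m) (F : Rel k) {v a b c u p q r} →
                E v a ≡ F u p → E v b ≡ F u q → E v c ≡ F u r →
                nbrCount E v a b c ≡ nbrCount F u p q r
nbrCount-cong _ _ e₁ e₂ e₃ rewrite e₁ | e₂ | e₃ = refl

module _ {m : ℕ} where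

  singleEdge⇒ends : ∀ {a b x y : Fin m} → singleEdge a b x y ≡ true →
                    (x ≡ a × y ≡ b) ⊎ (x ≡ b × y ≡ a)
  singleEdge⇒ends {a} {b} {x} {y} h with x ≟ᶠ a | y ≟ᶠ b | x ≟ᶠ b | y ≟ᶠ a
  ... | yes x≡a | yes y≡b | _       | _       = inj₁ (x≡a , y≡b)
  ... | _       | _       | yes x≡b | yes y≡a = inj₂ (x≡b , y≡a)
  ... | no _    | _       | no _    | _       = ⊥-elim (not-¬ {false} refl h)
  ... | no _    | _       | yes _   | no _    = ⊥-elim (not-¬ {false} refl h)
  ... | yes _   | no _    | no _    | _       = ⊥-elim (not-¬ {false} refl h)
  ... | yes _   | no _    | yes _   | no _    = ⊥-elim (not-¬ {false} refl h)

  ends⇒singleEdge : ∀ {a b x y : Fin m} → (x ≡ a × y ≡ b) ⊎ (x ≡ b × y ≡ a) →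
                    singleEdge a b x y ≡ true
  ends⇒singleEdge {a} {b} (inj₁ (refl , refl))
    rewrite ≡-≟-identity _≟ᶠ_ (refl {x = a}) | ≡-≟-identity _≟ᶠ_ (refl {x = b}) = refl
  ends⇒singleEdge {a} {b} (inj₂ (refl , refl))
    rewrite ≡-≟-identity _≟ᶠ_ (refl {x = a}) | ≡-≟-identity _≟ᶠ_ (refl {x = b}) = ∨-zeroʳ _

  singleEdge-sym : ∀ (a b x y : Fin m) → singleEdge a b x y ≡ singleEdge a b y x
  singleEdge-sym a b x y = ⇔→≡ (mk⇔ (flip x y) (flip y x))
    where
    flip : ∀ x y → singleEdge a b x y ≡ true → singleEdge a b y x ≡ true
    flip x y h = ends⇒singleEdge {a} {b} {y} {x}
      (Sum.swap (Sum.map Product.swap Product.swap (singleEdge⇒ends {a} {b} {x} {y} h)))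

  removeEdges-singleEdge-removed : ∀ (E : Rel m) (u s : Fin m) →
                                   removeEdges E (singleEdge u s) u s ≡ false
  removeEdges-singleEdge-removed E u s
    rewrite ends⇒singleEdge {u} {s} (inj₁ (refl , refl)) = ∧-zeroʳ (E u s)

  removeEdges-singleEdge-kept : ∀ (E : Rel m) {u s t : Fin m} → u ≢ s → t ≢ s →
                                removeEdges E (singleEdge u s) u t ≡ E u t
  removeEdges-singleEdge-kept E {u} {s} {t} u≢s t≢s
    rewrite ¬-not {singleEdge u s u t} (Sum.[ t≢s ∘ proj₂ , u≢s ∘ proj₁ ] ∘ singleEdge⇒ends) =
      ∧-identityʳ (E u t)

  removeEdges-∨ : ∀ (E X Y : Rel m) x y →
    removeEdges E (λ u v → X u v ∨ Y u v) x y ≡ removeEdges (removeEdges E X) Y x y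
  removeEdges-∨ E X Y x y with E x y | X x y
  ... | true  | true  = refl
  ... | true  | false = refl
  ... | false | _     = refl

  removeEdges-nonadjacent : ∀ (E F : Rel m) {x y} → E x y ≡ false →
                            removeEdges E F x y ≡ false
  removeEdges-nonadjacent _ _ e rewrite e = refl

  triad-stable : ∀ {E : Rel m} → (∀ x y → E x y ≡ E y x) → (∀ x → E x x ≡ false) →
                 ∀ {p q r u w} → IsTriadR E p q r → Among u p q r → Among w p q r →
                 E u w ≡ false
  triad-stable {E} E-sym E-irr {p} {q} {r} (_ , _ , _ , pq , pr , qr) = stable
    where
    stable : ∀ {u w} → Among u p q r → Among w p q r → E u w ≡ false
    stable (inj₁ refl)        (inj₁ refl)        = E-irr p
    stable (inj₁ refl)        (inj₂ (inj₁ refl)) = pq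
    stable (inj₁ refl)        (inj₂ (inj₂ refl)) = pr
    stable (inj₂ (inj₁ refl)) (inj₁ refl)        = trans (E-sym q p) pq
    stable (inj₂ (inj₁ refl)) (inj₂ (inj₁ refl)) = E-irr q
    stable (inj₂ (inj₁ refl)) (inj₂ (inj₂ refl)) = qr
    stable (inj₂ (inj₂ refl)) (inj₁ refl)        = trans (E-sym r p) pr
    stable (inj₂ (inj₂ refl)) (inj₂ (inj₁ refl)) = trans (E-sym r q) qr
    stable (inj₂ (inj₂ refl)) (inj₂ (inj₂ refl)) = E-irr r

  triad-swap₂₃ : ∀ {E : Rel m} → (∀ x y → E x y ≡ E y x) → ∀ {a b c} →
                 IsTriadR E a b c → IsTriadR E a c b
  triad-swap₂₃ E-sym {b = b} {c} (a≢b , a≢c , b≢c , ab , ac , bc) =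
    a≢c , a≢b , b≢c ∘ sym , ac , ab , trans (E-sym c b) bc

  triad-rotate : ∀ {E : Rel m} → (∀ x y → E x y ≡ E y x) → ∀ {a b c} →
                 IsTriadR E a b c → IsTriadR E b c a
  triad-rotate E-sym {a} {b} {c} (a≢b , a≢c , b≢c , ab , ac , bc) =
    b≢c , a≢b ∘ sym , a≢c ∘ sym , bc , trans (E-sym b a) ab , trans (E-sym c a) ac

  nbrCount≡2 : ∀ (E : Rel m) {v a b c} → E v a ≡ true → E v b ≡ true → E v c ≡ false →
               nbrCount E v a b c ≡ 2
  nbrCount≡2 _ e₁ e₂ e₃ rewrite e₁ | e₂ | e₃ = refl

  module _ (E F : Rel m) {u p q r : Fin m} where

    nbrCount-drop₁ : E u p ≡ true → F u p ≡ false → F u q ≡ E u q → F u r ≡ E u r →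
                     nbrCount E u p q r ≡ suc (nbrCount F u p q r)
    nbrCount-drop₁ e f g h rewrite e | f | g | h = refl

    nbrCount-drop₂ : E u q ≡ true → F u q ≡ false → F u p ≡ E u p → F u r ≡ E u r →
                     nbrCount E u p q r ≡ suc (nbrCount F u p q r)
    nbrCount-drop₂ e f g h rewrite e | f | g | h with E u p
    ... | true  = refl
    ... | false = refl

    nbrCount-drop₃ : E u r ≡ true → F u r ≡ false → F u p ≡ E u p → F u q ≡ E u q →
                     nbrCount E u p q r ≡ suc (nbrCount F u p q r)
    nbrCount-drop₃ e f g h rewrite e | f | g | h with E u p | E u q
    ... | true  | true  = refl
    ... | true  | false = refl
    ... | false | true  = refl
    ... | false | false = refl

  nbrCount-removeEdge : ∀ (E : Rel m) {u s p q r} → E u s ≡ true → u ≢ s → Among s p q r →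
    p ≢ q → p ≢ r → q ≢ r →
    nbrCount E u p q r ≡ suc (nbrCount (removeEdges E (singleEdge u s)) u p q r)
  nbrCount-removeEdge E {u} {s} e u≢s (inj₁ refl) p≢q p≢r q≢r =
    nbrCount-drop₁ E (removeEdges E (singleEdge u s)) e (removeEdges-singleEdge-removed E u s)
      (removeEdges-singleEdge-kept E u≢s (p≢q ∘ sym)) (removeEdges-singleEdge-kept E u≢s (p≢r ∘ sym))
  nbrCount-removeEdge E {u} {s} e u≢s (inj₂ (inj₁ refl)) p≢q p≢r q≢r =
    nbrCount-drop₂ E (removeEdges E (singleEdge u s)) e (removeEdges-singleEdge-removed E u s)
      (removeEdges-singleEdge-kept E u≢s p≢q) (removeEdges-singleEdge-kept E u≢s (q≢r ∘ sym))
  nbrCount-removeEdge E {u} {s} e u≢s (inj₂ (inj₂ refl)) p≢q p≢r q≢r =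
    nbrCount-drop₃ E (removeEdges E (singleEdge u s)) e (removeEdges-singleEdge-removed E u s)
      (removeEdges-singleEdge-kept E u≢s p≢r) (removeEdges-singleEdge-kept E u≢s q≢r)

  largest : ∀ {P : Subset m → Set} → (∀ C → Dec (P C)) → ∃[ D ] P D →
            ∃[ C ] (P C × (∀ D → P D → ∣ D ∣ ≤ ∣ C ∣))
  largest {P} P? (D₀ , PD₀) = below m (λ D _ → ∣p∣≤n D)
    where
    below : ∀ k → (∀ D → P D → ∣ D ∣ ≤ k) → ∃[ C ] (P C × (∀ D → P D → ∣ D ∣ ≤ ∣ C ∣))
    below k bound with anySubset? (λ D → P? D ×-dec (k ≤? ∣ D ∣))
    ... | yes (C , PC , k≤∣C∣) = C , PC , λ D PD → ≤-trans (bound D PD) k≤∣C∣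
    below zero    _     | no none = ⊥-elim (none (D₀ , PD₀ , z≤n))
    below (suc k) bound | no none = below k (λ D PD → ≤-pred (≰⇒> (λ k< → none (D , PD , k<))))

x∈p⇒1≤∣p∣ : ∀ {m} {p : Subset m} {x} → x ∈ p → 1 ≤ ∣ p ∣
x∈p⇒1≤∣p∣ here = s≤s z≤n
x∈p⇒1≤∣p∣ {p = s ∷ p} (there x∈p) = ≤-trans (x∈p⇒1≤∣p∣ x∈p) (∣p∣≤∣x∷p∣ s p)

x,y∈p⇒2≤∣p∣ : ∀ {m} {p : Subset m} {x y} → x ∈ p → y ∈ p → x ≢ y → 2 ≤ ∣ p ∣
x,y∈p⇒2≤∣p∣ here        here        x≢y = ⊥-elim (x≢y refl)
x,y∈p⇒2≤∣p∣ here        (there y∈p) _   = s≤s (x∈p⇒1≤∣p∣ y∈p)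
x,y∈p⇒2≤∣p∣ (there x∈p) here        _   = s≤s (x∈p⇒1≤∣p∣ x∈p)
x,y∈p⇒2≤∣p∣ {p = s ∷ p} (there x∈p) (there y∈p) x≢y =
  ≤-trans (x,y∈p⇒2≤∣p∣ x∈p y∈p (x≢y ∘ cong suc)) (∣p∣≤∣x∷p∣ s p)

x,y,z∈p⇒3≤∣p∣ : ∀ {m} {p : Subset m} {x y z} → x ∈ p → y ∈ p → z ∈ p →
                x ≢ y → x ≢ z → y ≢ z → 3 ≤ ∣ p ∣
x,y,z∈p⇒3≤∣p∣ here        here        _           x≢y _   _   = ⊥-elim (x≢y refl)
x,y,z∈p⇒3≤∣p∣ here        _           here        _   x≢z _   = ⊥-elim (x≢z refl)
x,y,z∈p⇒3≤∣p∣ _           here        here        _   _   y≢z = ⊥-elim (y≢z refl)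
x,y,z∈p⇒3≤∣p∣ here        (there y∈p) (there z∈p) _   _   y≢z = s≤s (x,y∈p⇒2≤∣p∣ y∈p z∈p (y≢z ∘ cong suc))
x,y,z∈p⇒3≤∣p∣ (there x∈p) here        (there z∈p) _   x≢z _   = s≤s (x,y∈p⇒2≤∣p∣ x∈p z∈p (x≢z ∘ cong suc))
x,y,z∈p⇒3≤∣p∣ (there x∈p) (there y∈p) here        x≢y _   _   = s≤s (x,y∈p⇒2≤∣p∣ x∈p y∈p (x≢y ∘ cong suc))
x,y,z∈p⇒3≤∣p∣ {p = s ∷ p} (there x∈p) (there y∈p) (there z∈p) x≢y x≢z y≢z =
  ≤-trans (x,y,z∈p⇒3≤∣p∣ x∈p y∈p z∈p (x≢y ∘ cong suc) (x≢z ∘ cong suc) (y≢z ∘ cong suc)) (∣p∣≤∣x∷p∣ s p)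

module _ {G : Graph} where

  IsMaximumCliqueIn : Subset (n G) → Subset (n G) → Set
  IsMaximumCliqueIn S C =
    IsCliqueIn (adj G) S C × (∀ D → IsCliqueIn (adj G) S D → ∣ D ∣ ≤ ∣ C ∣)

  maximumClique : ∀ S → ∃[ C ] IsMaximumCliqueIn S C
  maximumClique S = largest clique? (∅ , (⊥-elim ∘ ∉⊥) , λ _ _ x∈∅ → ⊥-elim (∉⊥ x∈∅))
    where
    clique? : ∀ C → Dec (IsCliqueIn (adj G) S C)
    clique? C = (C ⊆? S) ×-dec all? λ x → all? λ y →
      (x ∈? C) →-dec (y ∈? C) →-dec ¬? (x ≟ᶠ y) →-dec (adj G x y ≟ᵇ true)

  -- Otherwise C would stay a maximum clique after deleting the edge a b.
  skeletal⇒edge∈maximumClique : IsSkeletal G → ∀ {A B C a b} →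
    IsHomogeneousPairOfCliques G A B → a ∈ A → b ∈ B → Adj G a b →
    IsMaximumCliqueIn (A ∪ B) C → a ∈ C × b ∈ C
  skeletal⇒edge∈maximumClique skeletal {A} {B} {C} {a} {b} hom a∈A b∈B ab (C-clique , C-max)
    with (a ∈? C) ×-dec (b ∈? C)
  ... | yes ab∈C = ab∈C
  ... | no ab∉C  = ⊥-elim (skeletal A B hom a b a∈A b∈B ab ∣ C ∣ ω ω-without-ab)
    where
    ω : IsCliqueNumberOf (adj G) (A ∪ B) ∣ C ∣
    ω = (C , C-clique , refl) , C-max

    kept : ∀ x y → x ∈ C → y ∈ C → singleEdge a b x y ≡ false
    kept x y x∈C y∈C = ¬-not λ se → ab∉C (ends∈C (singleEdge⇒ends se))
      where
      ends∈C : (x ≡ a × y ≡ b) ⊎ (x ≡ b × y ≡ a) → a ∈ C × b ∈ C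
      ends∈C (inj₁ (refl , refl)) = x∈C , y∈C
      ends∈C (inj₂ (refl , refl)) = y∈C , x∈C

    ω-without-ab : IsCliqueNumberOf (removeEdges (adj G) (singleEdge a b)) (A ∪ B) ∣ C ∣
    ω-without-ab =
        (C , (proj₁ C-clique , λ x y x∈C y∈C x≢y →
               subst (λ e → adj G x y ∧ not e ≡ true) (sym (kept x y x∈C y∈C))
                 (trans (∧-identityʳ _) (proj₂ C-clique x y x∈C y∈C x≢y))) , refl)
      , λ D (D⊆ , D-clique) → C-max D (D⊆ , λ x y x∈D y∈D x≢y →
                                 ∧-conicalˡ _ _ (D-clique x y x∈D y∈D x≢y))

  skeletal⇒crossingEdges : IsSkeletal G → ∀ {A B a₁ b₁ a₂ b₂} →
    IsHomogeneousPairOfCliques G A B → a₁ ∈ A → b₁ ∈ B → a₂ ∈ A → b₂ ∈ B →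
    Adj G a₁ b₁ → Adj G a₂ b₂ → Adj G a₁ b₂
  skeletal⇒crossingEdges skeletal {A} {B} hom a₁∈A b₁∈B a₂∈A b₂∈B a₁b₁ a₂b₂
    with maximumClique (A ∪ B)
  ... | C , C-max@(C-clique , _) =
    proj₂ C-clique _ _ (proj₁ (edge∈C a₁∈A b₁∈B a₁b₁)) (proj₂ (edge∈C a₂∈A b₂∈B a₂b₂))
      (λ { refl → proj₁ hom _ a₁∈A b₂∈B })
    where
    edge∈C : ∀ {a b} → a ∈ A → b ∈ B → Adj G a b → a ∈ C × b ∈ C
    edge∈C a∈A b∈B ab = skeletal⇒edge∈maximumClique skeletal hom a∈A b∈B ab C-max

module Changeable {H : Graph} {M : Rel (n H)}
  (matching : IsMatching H M) (changeable : IsChangeable H M)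
  (X : Rel (n H)) (X-sym : ∀ u v → X u v ≡ X v u) (X⊆M : ∀ u v → X u v ≡ true → M u v ≡ true)
  {p q r : Fin (n H)} (X-within : ∀ u v → X u v ≡ true → Among u p q r)
  (triad : IsTriadR (removeEdges (adj H) X) p q r) where

  H-X : Rel (n H)
  H-X = removeEdges (adj H) X

  H-X-outside : ∀ {u} → u ≢ p → u ≢ q → u ≢ r → ∀ t → H-X u t ≡ adj H u t
  H-X-outside {u} u≢p u≢q u≢r t
    rewrite ¬-not {X u t} (Sum.[ u≢p , Sum.[ u≢q , u≢r ] ] ∘ X-within u t) = ∧-identityʳ _

  nbrCount-outside : ∀ {u} → u ≢ p → u ≢ q → u ≢ r → nbrCount (adj H) u p q r ≡ 2
  nbrCount-outside {u} u≢p u≢q u≢r =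
    trans (nbrCount-cong (adj H) H-X (sym (outside p)) (sym (outside q)) (sym (outside r)))
          (changeable X X-sym X⊆M p q r triad u u≢p u≢q u≢r)
    where
    outside : ∀ t → H-X u t ≡ adj H u t
    outside = H-X-outside u≢p u≢q u≢r

  -- Deleting the edge u s as well keeps the triad and drops the count of u to 1.
  unmatched-outside : ∀ {u s} → u ≢ p → u ≢ q → u ≢ r → Among s p q r → M u s ≡ false
  unmatched-outside {u} {s} u≢p u≢q u≢r s∈T = ¬-not matched⇒⊥
    where
    p≢q : p ≢ q
    p≢q = proj₁ triad
    p≢r : p ≢ r
    p≢r = proj₁ (proj₂ triad)
    q≢r : q ≢ r
    q≢r = proj₁ (proj₂ (proj₂ triad))

    u≢s : u ≢ s
    u≢s refl = Sum.[ u≢p , Sum.[ u≢q , u≢r ] ] s∈T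

    matched⇒⊥ : ¬ (M u s ≡ true)
    matched⇒⊥ us∈M = 1+n≢n (sym (begin
      2                                 ≡⟨ sym (changeable X X-sym X⊆M p q r triad u u≢p u≢q u≢r) ⟩
      nbrCount H-X u p q r              ≡⟨ nbrCount-removeEdge H-X us∈H-X u≢s s∈T p≢q p≢r q≢r ⟩
      suc (nbrCount H-X-us u p q r)     ≡⟨ cong suc (nbrCount-cong H-X-us H-X' (split p) (split q) (split r)) ⟩
      suc (nbrCount H-X' u p q r)       ≡⟨ cong suc (changeable X' X'-sym X'⊆M p q r triad' u u≢p u≢q u≢r) ⟩
      3                                 ∎))
      where
      open ≡-Reasoning

      us∈H-X : H-X u s ≡ true
      us∈H-X = trans (H-X-outside u≢p u≢q u≢r s) (proj₁ (proj₂ matching) u s us∈M)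

      X' : Rel (n H)
      X' x y = X x y ∨ singleEdge u s x y

      H-X-us : Rel (n H)
      H-X-us = removeEdges H-X (singleEdge u s)

      H-X' : Rel (n H)
      H-X' = removeEdges (adj H) X'

      split : ∀ t → H-X-us u t ≡ H-X' u t
      split t = sym (removeEdges-∨ (adj H) X (singleEdge u s) u t)

      X'-sym : ∀ x y → X' x y ≡ X' y x
      X'-sym x y = cong₂ _∨_ (X-sym x y) (singleEdge-sym u s x y)

      X'⊆M : ∀ x y → X' x y ≡ true → M x y ≡ true
      X'⊆M x y h with X x y in e
      ... | true  = X⊆M x y e
      ... | false with singleEdge⇒ends {a = u} {s} {x} {y} h
      ...   | inj₁ (refl , refl) = us∈M
      ...   | inj₂ (refl , refl) = trans (proj₁ matching s u) us∈M

      still : ∀ {x y} → H-X x y ≡ false → H-X' x y ≡ false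
      still {x} {y} e = trans (removeEdges-∨ (adj H) X (singleEdge u s) x y)
                              (removeEdges-nonadjacent H-X (singleEdge u s) e)

      triad' : IsTriadR H-X' p q r
      triad' = stillTriad triad
        where
        stillTriad : IsTriadR H-X p q r → IsTriadR H-X' p q r
        stillTriad (p≢q , p≢r , q≢r , pq , pr , qr) = p≢q , p≢r , q≢r , still pq , still pr , still qr

  unmatched-triadVertex : ∀ {u} → Among u p q r → (∀ w → Among w p q r → M u w ≡ false) →
                          ∀ w → M u w ≡ false
  unmatched-triadVertex {u} u∈T inside w with w ≟ᶠ p | w ≟ᶠ q | w ≟ᶠ r
  ... | yes w≡p | _       | _       = inside w (inj₁ w≡p)
  ... | no _    | yes w≡q | _       = inside w (inj₂ (inj₁ w≡q))
  ... | no _    | no _    | yes w≡r = inside w (inj₂ (inj₂ w≡r))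
  ... | no w≢p  | no w≢q  | no w≢r  =
    trans (proj₁ matching u w) (unmatched-outside w≢p w≢q w≢r u∈T)

module SkeletalThickening {G H : Graph} {M : Rel (n H)} {φ : Fin (n G) → Fin (n H)}
  (matching : IsMatching H M) (thickening : IsThickeningVia G H M φ)
  (skeletal : IsSkeletal G) where

  M-sym : ∀ {u v} → M u v ≡ true → M v u ≡ true
  M-sym {u} {v} = trans (proj₁ matching v u)

  M⇒adj : ∀ {u v} → M u v ≡ true → adj H u v ≡ true
  M⇒adj = proj₁ (proj₂ matching) _ _

  M-functional : ∀ {u v w} → M u v ≡ true → M u w ≡ true → v ≡ w
  M-functional = proj₂ (proj₂ matching) _ _ _

  M⇒≢ : ∀ {u v} → M u v ≡ true → u ≢ v
  M⇒≢ {u} uu∈M refl = not-¬ (irrefl H u) (M⇒adj uu∈M)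

  class-nonempty : ∀ s → ∃[ x ] φ x ≡ s
  class-nonempty = proj₁ thickening

  class-clique : ∀ {x y} → φ x ≡ φ y → x ≢ y → Adj G x y
  class-clique = proj₁ (proj₂ thickening) _ _

  adj-lift : ∀ {x y s t} → φ x ≡ s → φ y ≡ t → s ≢ t → M s t ≡ false →
             adj G x y ≡ adj H s t
  adj-lift {x} {y} refl refl s≢t st∉M with adj H (φ x) (φ y) in st
  ... | true  = proj₁ (proj₂ (proj₂ thickening)) x y s≢t st st∉M
  ... | false = proj₁ (proj₂ (proj₂ (proj₂ thickening))) x y s≢t st

  nonadj-lift : ∀ {x y s t} → φ x ≡ s → φ y ≡ t → s ≢ t → adj H s t ≡ false →
                adj G x y ≡ false
  nonadj-lift refl refl = proj₁ (proj₂ (proj₂ (proj₂ thickening))) _ _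

  matched-split : ∀ {s t} → M s t ≡ true →
      (∃[ x ] ∃[ y ] (φ x ≡ s × φ y ≡ t × adj G x y ≡ true))
    × (∃[ x ] ∃[ y ] (φ x ≡ s × φ y ≡ t × adj G x y ≡ false))
  matched-split = proj₂ (proj₂ (proj₂ (proj₂ thickening))) _ _

  nonadjacent⇒differentClasses : ∀ {x y} → adj G x y ≡ false → x ≢ y → φ x ≢ φ y
  nonadjacent⇒differentClasses xy∉G x≢y same = not-¬ xy∉G (class-clique same x≢y)

  nonadjacent⇒nonadjacent⊎matched : ∀ {x y} → adj G x y ≡ false → φ x ≢ φ y →
    adj H (φ x) (φ y) ≡ false ⊎ M (φ x) (φ y) ≡ true
  nonadjacent⇒nonadjacent⊎matched {x} {y} xy∉G φx≢φy
    with adj H (φ x) (φ y) in st | M (φ x) (φ y) in st∈M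
  ... | false | _     = inj₁ refl
  ... | true  | true  = inj₂ refl
  ... | true  | false = ⊥-elim (not-¬ xy∉G (trans (adj-lift refl refl φx≢φy st∈M) st))

  I : Fin (n H) → Subset (n G)
  I s = tabulate λ x → ⌊ φ x ≟ᶠ s ⌋

  ∈I : ∀ {x s} → φ x ≡ s → x ∈ I s
  ∈I {x} {s} x∈s = lookup⇒[]= x (I s)
    (trans (lookup∘tabulate _ x) (trans (isYes≗does (φ x ≟ᶠ s)) (dec-true (φ x ≟ᶠ s) x∈s)))

  ∈I⁻¹ : ∀ {x s} → x ∈ I s → φ x ≡ s
  ∈I⁻¹ {x} {s} x∈s
    with φ x ≟ᶠ s | trans (sym (lookup∘tabulate (λ y → ⌊ φ y ≟ᶠ s ⌋) x)) ([]=⇒lookup x∈s)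
  ... | yes x∈s | _ = x∈s
  ... | no _    | ()

  adjacency-to-class : ∀ {v s} → φ v ≢ s → M (φ v) s ≡ false →
    (∀ x → x ∈ I s → Adj G v x) ⊎ (∀ x → x ∈ I s → ¬ Adj G v x)
  adjacency-to-class {v} {s} v∉s vs∉M with adj H (φ v) s in vs
  ... | true  = inj₁ λ x x∈s → trans (adj-lift refl (∈I⁻¹ x∈s) v∉s vs∉M) vs
  ... | false = inj₂ λ x x∈s → not-¬ (trans (adj-lift refl (∈I⁻¹ x∈s) v∉s vs∉M) vs)

  matched-homogeneousPair : ∀ {s t} → M s t ≡ true → 3 ≤ ∣ I s ∪ I t ∣ →
                            IsHomogeneousPairOfCliques G (I s) (I t)
  matched-homogeneousPair {s} {t} st∈M size =
      (λ x x∈s x∈t → M⇒≢ st∈M (trans (sym (∈I⁻¹ x∈s)) (∈I⁻¹ x∈t)))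
    , Product.map₂ ∈I (class-nonempty s) , Product.map₂ ∈I (class-nonempty t)
    , (λ x y x∈s y∈s → class-clique (trans (∈I⁻¹ x∈s) (sym (∈I⁻¹ y∈s))))
    , (λ x y x∈t y∈t → class-clique (trans (∈I⁻¹ x∈t) (sym (∈I⁻¹ y∈t))))
    , size
    , λ v v∉s v∉t →
        adjacency-to-class (v∉s ∘ ∈I) (¬-not λ vs∈M → v∉t (∈I (M-functional (M-sym vs∈M) st∈M)))
      , adjacency-to-class (v∉t ∘ ∈I) (¬-not λ vt∈M → v∉s (∈I (M-functional (M-sym vt∈M) (M-sym st∈M))))

  matched-crossingEdges : ∀ {s t x₁ y₁ x₂ y₂} → M s t ≡ true →
    φ x₁ ≡ s → φ y₁ ≡ t → φ x₂ ≡ s → φ y₂ ≡ t →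
    Adj G x₁ y₁ → Adj G x₂ y₂ → Adj G x₁ y₂
  matched-crossingEdges {s} {t} {x₁} {y₁} {x₂} {y₂} st∈M x₁∈s y₁∈t x₂∈s y₂∈t x₁y₁ x₂y₂
    with x₁ ≟ᶠ x₂ | y₁ ≟ᶠ y₂
  ... | yes refl | _        = x₂y₂
  ... | no _     | yes refl = x₁y₁
  ... | no x₁≢x₂ | no _     =
    skeletal⇒crossingEdges {G = G} skeletal (matched-homogeneousPair st∈M size)
      (∈I x₁∈s) (∈I y₁∈t) (∈I x₂∈s) (∈I y₂∈t) x₁y₁ x₂y₂
    where
    apart : ∀ {x y} → φ x ≡ s → φ y ≡ t → x ≢ y
    apart x∈s y∈t refl = M⇒≢ st∈M (trans (sym x∈s) y∈t)

    size : 3 ≤ ∣ I s ∪ I t ∣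
    size = x,y,z∈p⇒3≤∣p∣ (p⊆p∪q (I t) (∈I x₁∈s)) (p⊆p∪q (I t) (∈I x₂∈s)) (q⊆p∪q (I s) (I t) (∈I y₁∈t))
             x₁≢x₂ (apart x₁∈s y₁∈t) (apart x₂∈s y₁∈t)

  matched-nonadjacent⇒anticomplete : ∀ {s t x y} → M s t ≡ true → φ x ≡ s → φ y ≡ t →
    adj G x y ≡ false →
    (∀ x′ → φ x′ ≡ s → adj G x′ y ≡ false) ⊎ (∀ y′ → φ y′ ≡ t → adj G x y′ ≡ false)
  matched-nonadjacent⇒anticomplete {s} {t} {x} {y} st∈M x∈s y∈t xy∉G
    with any? (λ x′ → (φ x′ ≟ᶠ s) ×-dec (adj G x′ y ≟ᵇ true))
  ... | no none = inj₁ λ x′ x′∈s → ¬-not λ x′y → none (x′ , x′∈s , x′y)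
  ... | yes (x′ , x′∈s , x′y) = inj₂ λ y′ y′∈t → ¬-not λ xy′ →
          not-¬ xy∉G (matched-crossingEdges st∈M x∈s y′∈t x′∈s y∈t xy′ x′y)

  closedNbhd-⊆ : ∀ {v a} → φ v ≡ φ a → v ≢ a →
    (∀ y → M (φ a) (φ y) ≡ true → Adj G v y → Adj G a y) →
    ∀ w → InClosedNbhd G v w → InClosedNbhd G a w
  closedNbhd-⊆ va v≢a partners w (inj₁ refl) = inj₂ (class-clique (sym va) (v≢a ∘ sym))
  closedNbhd-⊆ {v} {a} va v≢a partners w (inj₂ vw)
    with w ≟ᶠ a | φ w ≟ᶠ φ a | M (φ a) (φ w) in aw∈M
  ... | yes w≡a | _       | _     = inj₁ w≡a
  ... | no w≢a  | yes wa  | _     = inj₂ (class-clique (sym wa) (w≢a ∘ sym))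
  ... | no _    | no _    | true  = inj₂ (partners w aw∈M vw)
  ... | no _    | no w≁a  | false =
    inj₂ (trans (adj-lift refl refl (w≁a ∘ sym) aw∈M) (trans (sym (adj-lift va refl (w≁a ∘ sym) aw∈M)) vw))

  twins : ∀ {v a} → φ v ≡ φ a → v ≢ a → (∀ w → M (φ a) w ≡ false) → AreTwins G v a
  twins {v} {a} va v≢a a-unmatched w = mk⇔
    (closedNbhd-⊆ va v≢a (λ y ay∈M _ → ⊥-elim (not-¬ (a-unmatched (φ y)) ay∈M)) w)
    (closedNbhd-⊆ (sym va) (v≢a ∘ sym)
      (λ y vy∈M _ → ⊥-elim (not-¬ (a-unmatched (φ y)) (subst (λ z → M z (φ y) ≡ true) va vy∈M))) w)

  nbrCount-lift : ∀ {v a b c} → φ v ≢ φ a → φ v ≢ φ b → φ v ≢ φ c →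
    (∀ s → Among s (φ a) (φ b) (φ c) → M (φ v) s ≡ false) →
    nbrCount (adj G) v a b c ≡ nbrCount (adj H) (φ v) (φ a) (φ b) (φ c)
  nbrCount-lift va vb vc unmatched = nbrCount-cong (adj G) (adj H)
    (adj-lift refl refl va (unmatched _ (inj₁ refl)))
    (adj-lift refl refl vb (unmatched _ (inj₂ (inj₁ refl))))
    (adj-lift refl refl vc (unmatched _ (inj₂ (inj₂ refl))))

  module _ (changeable : IsChangeable H M) where

    goodTriad-unmatched : ∀ {a b c} → IsTriad G a b c →
      adj H (φ a) (φ b) ≡ false → adj H (φ a) (φ c) ≡ false → adj H (φ b) (φ c) ≡ false →
      IsGoodTriad G a b c
    goodTriad-unmatched {a} {b} {c} triad@(a≢b , a≢c , b≢c , ab , ac , bc) pq pr qr = triad , good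
      where
      p≢q : φ a ≢ φ b
      p≢q = nonadjacent⇒differentClasses ab a≢b
      p≢r : φ a ≢ φ c
      p≢r = nonadjacent⇒differentClasses ac a≢c
      q≢r : φ b ≢ φ c
      q≢r = nonadjacent⇒differentClasses bc b≢c

      triadH : IsTriadR (adj H) (φ a) (φ b) (φ c)
      triadH = p≢q , p≢r , q≢r , pq , pr , qr

      open Changeable {H = H} {M} matching changeable (λ _ _ → false) (λ _ _ → refl) (λ _ _ ()) (λ _ _ ())
        (p≢q , p≢r , q≢r , trans (∧-identityʳ _) pq , trans (∧-identityʳ _) pr , trans (∧-identityʳ _) qr)

      unmatched : ∀ {u} → Among u (φ a) (φ b) (φ c) → ∀ w → M u w ≡ false
      unmatched u∈T = unmatched-triadVertex u∈T λ w w∈T →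
        ¬-not (not-¬ (triad-stable (Graph.sym H) (irrefl H) triadH u∈T w∈T) ∘ M⇒adj)

      good : ∀ v → v ≢ a → v ≢ b → v ≢ c → GoodVertex G a b c v
      good v v≢a v≢b v≢c with φ v ≟ᶠ φ a | φ v ≟ᶠ φ b | φ v ≟ᶠ φ c
      ... | yes va | _      | _      = inj₂ (inj₁ (inj₁ (twins va v≢a (unmatched (inj₁ refl)))))
      ... | no _   | yes vb | _      = inj₂ (inj₁ (inj₂ (inj₁ (twins vb v≢b (unmatched (inj₂ (inj₁ refl)))))))
      ... | no _   | no _   | yes vc = inj₂ (inj₁ (inj₂ (inj₂ (twins vc v≢c (unmatched (inj₂ (inj₂ refl)))))))
      ... | no va  | no vb  | no vc  =
        inj₁ (trans (nbrCount-lift va vb vc (λ _ → unmatched-outside va vb vc)) (nbrCount-outside va vb vc))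

    goodTriad-matched : ∀ {p q r a b c y₀} → M p q ≡ true → p ≢ r → q ≢ r →
      adj H p r ≡ false → adj H q r ≡ false → φ a ≡ p → φ b ≡ q → φ c ≡ r →
      φ y₀ ≡ q → Adj G a y₀ → (∀ x → φ x ≡ p → adj G x b ≡ false) →
      IsGoodTriad G a b c
    goodTriad-matched {a = a} {b} {c} {y₀} pq∈M p≢r q≢r pr qr refl refl refl y₀∈q ay₀ b-anti =
      triad , good
      where
      p≢q : φ a ≢ φ b
      p≢q = M⇒≢ pq∈M

      X : Rel (n H)
      X = singleEdge (φ a) (φ b)

      X⊆M : ∀ u v → X u v ≡ true → M u v ≡ true
      X⊆M u v uv∈X with singleEdge⇒ends {a = φ a} {φ b} {u} {v} uv∈X
      ... | inj₁ (refl , refl) = pq∈M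
      ... | inj₂ (refl , refl) = M-sym pq∈M

      X-within : ∀ u v → X u v ≡ true → Among u (φ a) (φ b) (φ c)
      X-within u v uv∈X = Sum.map proj₁ (inj₁ ∘ proj₁) (singleEdge⇒ends {a = φ a} {φ b} {u} {v} uv∈X)

      open Changeable {H = H} {M} matching changeable X (singleEdge-sym (φ a) (φ b)) X⊆M X-within
        ( p≢q , p≢r , q≢r , removeEdges-singleEdge-removed (adj H) (φ a) (φ b)
        , removeEdges-nonadjacent (adj H) X pr , removeEdges-nonadjacent (adj H) X qr)

      c-unmatched : ∀ w → M (φ c) w ≡ false
      c-unmatched = unmatched-triadVertex (inj₂ (inj₂ refl)) inside
        where
        inside : ∀ w → Among w (φ a) (φ b) (φ c) → M (φ c) w ≡ false
        inside w (inj₁ refl)        = ¬-not λ m → q≢r (M-functional pq∈M (M-sym m))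
        inside w (inj₂ (inj₁ refl)) = ¬-not λ m → p≢r (M-functional (M-sym pq∈M) (M-sym m))
        inside w (inj₂ (inj₂ refl)) = ¬-not λ m → M⇒≢ m refl

      triad : IsTriad G a b c
      triad = p≢q ∘ cong φ , p≢r ∘ cong φ , q≢r ∘ cong φ
            , b-anti a refl , nonadj-lift refl refl p≢r pr , nonadj-lift refl refl q≢r qr

      partner∈I-b : ∀ {x y} → φ x ≡ φ a → M (φ x) (φ y) ≡ true → φ y ≡ φ b
      partner∈I-b {y = y} xa xy∈M = M-functional (subst (λ z → M z (φ y) ≡ true) xa xy∈M) pq∈M

      partner∈I-a : ∀ {x y} → φ x ≡ φ b → M (φ x) (φ y) ≡ true → φ y ≡ φ a
      partner∈I-a {y = y} xb xy∈M = sym (M-functional (M-sym pq∈M) (subst (λ z → M z (φ y) ≡ true) xb xy∈M))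

      I-a⊆a : ∀ {v} → φ v ≡ φ a → v ≢ a → ∀ w → InClosedNbhd G v w → InClosedNbhd G a w
      I-a⊆a va v≢a = closedNbhd-⊆ va v≢a λ y ay∈M vy →
        matched-crossingEdges pq∈M refl y₀∈q va (partner∈I-b refl ay∈M) ay₀ vy

      inI-a : ∀ {v} → φ v ≡ φ a → v ≢ a → GoodVertex G a b c v
      inI-a {v} va v≢a with adj G v y₀ in vy₀
      ... | true  = inj₂ (inj₁ (inj₁ λ w → mk⇔ (I-a⊆a va v≢a w) (a⊆v w)))
        where
        a⊆v : ∀ w → InClosedNbhd G a w → InClosedNbhd G v w
        a⊆v = closedNbhd-⊆ (sym va) (v≢a ∘ sym) λ y vy∈M ay →
          matched-crossingEdges pq∈M va y₀∈q refl (partner∈I-b va vy∈M) vy₀ ay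
      ... | false = inj₂ (inj₂ (inj₁ (I-a⊆a va v≢a , y₀ , inj₂ ay₀ , Sum.[ y₀≢v , not-¬ vy₀ ])))
        where
        y₀≢v : y₀ ≢ v
        y₀≢v refl = p≢q (trans (sym va) y₀∈q)

      inI-b : ∀ {v} → φ v ≡ φ b → v ≢ b → GoodVertex G a b c v
      inI-b {v} vb v≢b with adj G v a ≟ᵇ true
      ... | yes va = inj₁ (nbrCount≡2 (adj G) va (class-clique vb v≢b) (nonadj-lift vb refl q≢r qr))
      ... | no v≁a = inj₂ (inj₁ (inj₂ (inj₁ λ w → mk⇔ (v⊆b w) (b⊆v w))))
        where
        va : adj G v a ≡ false
        va = ¬-not v≁a

        v⊆b : ∀ w → InClosedNbhd G v w → InClosedNbhd G b w
        v⊆b = closedNbhd-⊆ vb v≢b λ y by∈M vy → ⊥-elim (not-¬ va (trans (Graph.sym G v a)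
          (matched-crossingEdges pq∈M refl y₀∈q (partner∈I-a refl by∈M) vb ay₀ (trans (Graph.sym G y v) vy))))

        b⊆v : ∀ w → InClosedNbhd G b w → InClosedNbhd G v w
        b⊆v = closedNbhd-⊆ (sym vb) (v≢b ∘ sym) λ y vy∈M by →
          ⊥-elim (not-¬ (b-anti y (partner∈I-a vb vy∈M)) (trans (Graph.sym G y b) by))

      good : ∀ v → v ≢ a → v ≢ b → v ≢ c → GoodVertex G a b c v
      good v v≢a v≢b v≢c with φ v ≟ᶠ φ a | φ v ≟ᶠ φ b | φ v ≟ᶠ φ c
      ... | yes va | _      | _      = inI-a va v≢a
      ... | no _   | yes vb | _      = inI-b vb v≢b
      ... | no _   | no _   | yes vc = inj₂ (inj₁ (inj₂ (inj₂ (twins vc v≢c c-unmatched))))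
      ... | no va  | no vb  | no vc  =
        inj₁ (trans (nbrCount-lift va vb vc (λ _ → unmatched-outside va vb vc)) (nbrCount-outside va vb vc))

    goodTriad-matchedPair : ∀ {a b c} → IsTriad G a b c → M (φ a) (φ b) ≡ true →
                            ∃[ a′ ] ∃[ b′ ] ∃[ c′ ] IsGoodTriad G a′ b′ c′
    goodTriad-matchedPair {a} {b} {c} (_ , a≢c , b≢c , _ , ac , bc) pq∈M =
      rechoose (matched-split pq∈M)
      where
      p≢r : φ a ≢ φ c
      p≢r = nonadjacent⇒differentClasses ac a≢c
      q≢r : φ b ≢ φ c
      q≢r = nonadjacent⇒differentClasses bc b≢c

      pr : adj H (φ a) (φ c) ≡ false
      pr = Sum.[ (λ pr → pr) , (λ pr∈M → ⊥-elim (q≢r (M-functional pq∈M pr∈M))) ]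
             (nonadjacent⇒nonadjacent⊎matched ac p≢r)

      qr : adj H (φ b) (φ c) ≡ false
      qr = Sum.[ (λ qr → qr) , (λ qr∈M → ⊥-elim (p≢r (M-functional (M-sym pq∈M) qr∈M))) ]
             (nonadjacent⇒nonadjacent⊎matched bc q≢r)

      rechoose : (∃[ x ] ∃[ y ] (φ x ≡ φ a × φ y ≡ φ b × adj G x y ≡ true))
               × (∃[ x ] ∃[ y ] (φ x ≡ φ a × φ y ≡ φ b × adj G x y ≡ false)) →
                 ∃[ a′ ] ∃[ b′ ] ∃[ c′ ] IsGoodTriad G a′ b′ c′
      rechoose ((x₀ , y₀ , x₀∈p , y₀∈q , x₀y₀) , (x₁ , y₁ , x₁∈p , y₁∈q , x₁y₁))
        with matched-nonadjacent⇒anticomplete pq∈M x₁∈p y₁∈q x₁y₁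
      ... | inj₁ y₁-anti = x₀ , y₁ , c ,
        goodTriad-matched pq∈M p≢r q≢r pr qr x₀∈p y₁∈q refl y₀∈q x₀y₀ y₁-anti
      ... | inj₂ x₁-anti = y₀ , x₁ , c ,
        goodTriad-matched (M-sym pq∈M) q≢r p≢r qr pr y₀∈q x₁∈p refl x₀∈p
          (trans (Graph.sym G y₀ x₀) x₀y₀) (λ y y∈q → trans (Graph.sym G y x₁) (x₁-anti y y∈q))

    goodTriad : ∀ {a b c} → IsTriad G a b c → ∃[ a′ ] ∃[ b′ ] ∃[ c′ ] IsGoodTriad G a′ b′ c′
    goodTriad {a} {b} {c} triad@(a≢b , a≢c , b≢c , ab , ac , bc)
      with nonadjacent⇒nonadjacent⊎matched ab (nonadjacent⇒differentClasses ab a≢b)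
         | nonadjacent⇒nonadjacent⊎matched ac (nonadjacent⇒differentClasses ac a≢c)
         | nonadjacent⇒nonadjacent⊎matched bc (nonadjacent⇒differentClasses bc b≢c)
    ... | inj₂ pq∈M | _         | _         = goodTriad-matchedPair triad pq∈M
    ... | _         | inj₂ pr∈M | _         = goodTriad-matchedPair (triad-swap₂₃ (Graph.sym G) triad) pr∈M
    ... | _         | _         | inj₂ qr∈M = goodTriad-matchedPair (triad-rotate (Graph.sym G) triad) qr∈M
    ... | inj₁ pq   | inj₁ pr   | inj₁ qr   = a , b , c , goodTriad-unmatched triad pq pr qr

corollary2p7 : (G : Graph) → IsSkeletal G → IsAntiprismaticThickening G →
    AlphaAtLeast3 G → ∃[ a ] ∃[ b ] ∃[ c ] IsGoodTriad G a b c
corollary2p7 G skeletal (H , M , φ , _ , matching , changeable , thickening) (_ , _ , _ , triad) =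
  SkeletalThickening.goodTriad {G = G} {H} {M} {φ} matching thickening skeletal changeable triad
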